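{- Let $a\in\mathbb{N}$ with $a\geq 3$ and let $S=\langle a,a+1,a+2\rangle$. Define $\mathscr{L}_a=\lfloor a/2\rfloor (a+2)$ if $a$ is even, and $\mathscr{L}_a=(\lfloor a/2\rfloor+2)a$ if $a$ is odd. Then $S\cap \llbracket 0,\mathscr{L}_a)\!)\subseteq \operatorname{ULF}(S)$ and $\mathscr{L}_a\notin \operatorname{ULF}(S)$. Moreover, for every $r\in S\cap\llbracket 0,\mathscr{L}_a)\!)$ one has $\operatorname{L}(r,S)=\{\lfloor r/a\rfloor\}$.
   Context: $\mathbb{N}=\{0,1,2,\dots\}$. $S=\langle a,a+1,a+2\rangle=\{\alpha_1a+\alpha_2(a+1)+\alpha_3(a+2):\alpha_i\in\mathbb{N}\}$. For $r\in\mathbb{N}$, the set of factorizations of $r$ is $\operatorname{F}(r,S)=\{\alpha\in\mathbb{N}^3:\alpha_1a+\alpha_2(a+1)+\alpha_3(a+2)=r\}$; the length of $\alpha$ is $|\alpha|=\alpha_1+\alpha_2+\alpha_3$; $\operatorname{L}(r,S)=\{|\alpha|:\alpha\in\operatorname{F}(r,S)\}$; and $\operatorname{ULF}(S)=\{r\in S:\operatorname{L}(r,S)\text{ has exactly one element}\}$. For integers $x,y$, $\llbracket x,y)\!)=\{n\in\mathbb{Z}:x\le n<y\}$. -}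

module Defs where

open import Data.Nat using (ℕ; zero; suc; _+_; _*_; _/_; _%_; _<_)
open import Data.Nat.Properties using ()
open import Data.Product using (Σ; ∃; _×_; _,_)
open import Relation.Binary.PropositionalEquality using (_≡_)

Factorization : Set
Factorization = ℕ × ℕ × ℕ

value : ℕ → Factorization → ℕ
value a (x , y , z) = x * a + y * (a + 1) + z * (a + 2)

len : Factorization → ℕ
len (x , y , z) = x + y + z

IsFactorization : ℕ → ℕ → Factorization → Set
IsFactorization a r α = value a α ≡ r

InS : ℕ → ℕ → Set
InS a r = ∃ λ α → IsFactorization a r α

InL : ℕ → ℕ → ℕ → Set
InL a r ℓ = ∃ λ α → IsFactorization a r α × len α ≡ ℓ

SingletonL : ℕ → ℕ → Set
SingletonL a r = ∃ λ ℓ → InL a r ℓ × (∀ k → InL a r k → k ≡ ℓ)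

InULF : ℕ → ℕ → Set
InULF a r = InS a r × SingletonL a r

𝓛 : ℕ → ℕ
𝓛 a with a % 2
... | zero = (a / 2) * (a + 2)
... | suc _ = (a / 2 + 2) * a

-- A factorization (x, y, z) of length ℓ has value ℓ a + t with excess t = y + 2z,
-- and the pairs (ℓ, t) that occur are exactly those with t ≤ 2ℓ. If t < a, the
-- length is ⌊r/a⌋. If t ≥ a, then a ≤ 2ℓ forces ℓ ≥ ⌈a/2⌉, so r ≥ (⌈a/2⌉ + 1) a,
-- which is 𝓛 a in both parity cases; and 𝓛 a is reached with length ⌈a/2⌉
-- (excess a) as well as with length ⌈a/2⌉ + 1 (excess 0).
{-# OPTIONS --safe #-}
module Submission where

open import Defs
open import Data.Nat using (ℕ; zero; suc; _+_; _*_; _/_; _%_; _<_; _≤_; _<?_; ⌊_/2⌋; ⌈_/2⌉; NonZero; z≤n; s≤s)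
open import Data.Nat.Properties
open import Data.Nat.DivMod using (m≡m%n+[m/n]*n; m%n<n; +-distrib-/-∣ˡ; m*n/n≡m; m<n⇒m/n≡0)
open import Data.Nat.Divisibility using (divides-refl)
open import Data.Nat.Tactic.RingSolver using (solve-∀)
open import Data.Product using (_×_; _,_; ∃)
open import Relation.Binary.PropositionalEquality using (_≡_; refl; sym; trans; cong; cong₂; subst; module ≡-Reasoning)
open import Relation.Nullary using (¬_; yes; no; contradiction)

excess : Factorization → ℕ
excess (x , y , z) = y + z + z

value≡len*a+excess : ∀ a α → value a α ≡ len α * a + excess α
value≡len*a+excess a (x , y , z) = lemma a x y z
  where
  lemma : ∀ a x y z → x * a + y * (a + 1) + z * (a + 2) ≡ (x + y + z) * a + (y + z + z)
  lemma = solve-∀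

excess≤len+len : ∀ α → excess α ≤ len α + len α
excess≤len+len (x , y , z) = +-mono-≤ y+z≤x+y+z (m≤n+m z (x + y))
  where
  y+z≤x+y+z : y + z ≤ x + y + z
  y+z≤x+y+z = ≤-trans (m≤n+m (y + z) x) (≤-reflexive (sym (+-assoc x y z)))

t≤ℓ+ℓ⇒∃[α]len≡ℓ×excess≡t : ∀ ℓ t → t ≤ ℓ + ℓ → ∃ λ α → len α ≡ ℓ × excess α ≡ t
t≤ℓ+ℓ⇒∃[α]len≡ℓ×excess≡t zero          zero          _ = (0 , 0 , 0) , refl , refl
t≤ℓ+ℓ⇒∃[α]len≡ℓ×excess≡t (suc ℓ)       zero          _ =
  (suc ℓ , 0 , 0) , cong suc (trans (+-identityʳ (ℓ + 0)) (+-identityʳ ℓ)) , refl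
t≤ℓ+ℓ⇒∃[α]len≡ℓ×excess≡t (suc ℓ)       (suc zero)    _ =
  (ℓ , 1 , 0) , trans (+-identityʳ (ℓ + 1)) (+-comm ℓ 1) , refl
t≤ℓ+ℓ⇒∃[α]len≡ℓ×excess≡t (suc ℓ)       (suc (suc t)) (s≤s t+1≤ℓ+ℓ+1)
  with (x , y , z) , len≡ℓ , excess≡t ← t≤ℓ+ℓ⇒∃[α]len≡ℓ×excess≡t ℓ t
         (≤-pred (≤-trans t+1≤ℓ+ℓ+1 (≤-reflexive (+-suc ℓ ℓ))))
  = (x , y , suc z)
  , trans (len-suc-z x y z) (cong suc len≡ℓ)
  , trans (excess-suc-z y z) (cong (λ n → suc (suc n)) excess≡t)
  where
  len-suc-z : ∀ x y z → x + y + suc z ≡ suc (x + y + z)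
  len-suc-z = solve-∀
  excess-suc-z : ∀ y z → y + suc z + suc z ≡ suc (suc (y + z + z))
  excess-suc-z = solve-∀

t≤ℓ+ℓ⇒InL[ℓ*a+t]ℓ : ∀ a ℓ t → t ≤ ℓ + ℓ → InL a (ℓ * a + t) ℓ
t≤ℓ+ℓ⇒InL[ℓ*a+t]ℓ a ℓ t t≤ℓ+ℓ with α , refl , refl ← t≤ℓ+ℓ⇒∃[α]len≡ℓ×excess≡t ℓ t t≤ℓ+ℓ
  = α , value≡len*a+excess a α , refl

[ℓ*a+t]/a≡ℓ : ∀ a ℓ t .⦃ _ : NonZero a ⦄ → t < a → (ℓ * a + t) / a ≡ ℓ
[ℓ*a+t]/a≡ℓ a ℓ t t<a = begin
  (ℓ * a + t) / a   ≡⟨ +-distrib-/-∣ˡ t (divides-refl ℓ) ⟩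
  ℓ * a / a + t / a ≡⟨ cong₂ _+_ (m*n/n≡m ℓ a) (m<n⇒m/n≡0 t<a) ⟩
  ℓ + 0             ≡⟨ +-identityʳ ℓ ⟩
  ℓ                 ∎
  where open ≡-Reasoning

n≤ℓ+ℓ⇒⌈n/2⌉≤ℓ : ∀ {n ℓ} → n ≤ ℓ + ℓ → ⌈ n /2⌉ ≤ ℓ
n≤ℓ+ℓ⇒⌈n/2⌉≤ℓ {ℓ = ℓ} n≤ℓ+ℓ = ≤-trans (⌈n/2⌉-mono n≤ℓ+ℓ) (≤-reflexive (sym (n≡⌈n+n/2⌉ ℓ)))

n≤⌈n/2⌉+⌈n/2⌉ : ∀ n → n ≤ ⌈ n /2⌉ + ⌈ n /2⌉
n≤⌈n/2⌉+⌈n/2⌉ n = ≤-trans (≤-reflexive (sym (⌊n/2⌋+⌈n/2⌉≡n n))) (+-monoˡ-≤ ⌈ n /2⌉ (⌊n/2⌋≤⌈n/2⌉ n))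

m+m≡m*2 : ∀ m → m + m ≡ m * 2
m+m≡m*2 = solve-∀

⌊m*2/2⌋≡m : ∀ m → ⌊ m * 2 /2⌋ ≡ m
⌊m*2/2⌋≡m m = sym (trans (n≡⌊n+n/2⌋ m) (cong ⌊_/2⌋ (m+m≡m*2 m)))

⌈m*2/2⌉≡m : ∀ m → ⌈ m * 2 /2⌉ ≡ m
⌈m*2/2⌉≡m m = sym (trans (n≡⌈n+n/2⌉ m) (cong ⌈_/2⌉ (m+m≡m*2 m)))

𝓛≡[1+⌈a/2⌉]*a : ∀ a → 𝓛 a ≡ suc ⌈ a /2⌉ * a
𝓛≡[1+⌈a/2⌉]*a a with a % 2 | m≡m%n+[m/n]*n a 2 | m%n<n a 2
... | 0           | a≡2m   | _ = even (a / 2) a≡2m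
  where
  even : ∀ {a} m → a ≡ m * 2 → m * (a + 2) ≡ suc ⌈ a /2⌉ * a
  even m refl = trans (ring m) (cong (λ k → suc k * (m * 2)) (sym (⌈m*2/2⌉≡m m)))
    where
    ring : ∀ m → m * (m * 2 + 2) ≡ suc m * (m * 2)
    ring = solve-∀
... | 1           | a≡2m+1 | _ = odd (a / 2) a≡2m+1
  where
  odd : ∀ {a} m → a ≡ suc (m * 2) → (m + 2) * a ≡ suc ⌈ a /2⌉ * a
  odd {a} m refl = trans (cong (_* a) (+-comm m 2)) (cong (λ k → suc (suc k) * a) (sym (⌊m*2/2⌋≡m m)))
... | suc (suc _) | _      | s≤s (s≤s ())

𝓛≤ℓ*a+t : ∀ a ℓ t → a ≤ t → t ≤ ℓ + ℓ → 𝓛 a ≤ ℓ * a + t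
𝓛≤ℓ*a+t a ℓ t a≤t t≤ℓ+ℓ = begin
  𝓛 a                 ≡⟨ 𝓛≡[1+⌈a/2⌉]*a a ⟩
  a + ⌈ a /2⌉ * a     ≤⟨ +-mono-≤ a≤t (*-monoˡ-≤ a (n≤ℓ+ℓ⇒⌈n/2⌉≤ℓ {ℓ = ℓ} (≤-trans a≤t t≤ℓ+ℓ))) ⟩
  t + ℓ * a           ≡⟨ +-comm t (ℓ * a) ⟩
  ℓ * a + t           ∎
  where open ≤-Reasoning

InL⇒ℓ≡r/a : ∀ a .⦃ _ : NonZero a ⦄ {r ℓ} → InL a r ℓ → r < 𝓛 a → ℓ ≡ r / a
InL⇒ℓ≡r/a a (α , refl , refl) r<𝓛 rewrite value≡len*a+excess a α with excess α <? a
... | yes excess<a = sym ([ℓ*a+t]/a≡ℓ a (len α) (excess α) excess<a)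
... | no  excess≮a =
  contradiction (𝓛≤ℓ*a+t a (len α) (excess α) (≮⇒≥ excess≮a) (excess≤len+len α)) (<⇒≱ r<𝓛)

InS⇒InL[r/a] : ∀ a .⦃ _ : NonZero a ⦄ {r} → InS a r → r < 𝓛 a → InL a r (r / a)
InS⇒InL[r/a] a (α , α∈F) r<𝓛 = α , α∈F , InL⇒ℓ≡r/a a (α , α∈F , refl) r<𝓛

𝓛∉ULF : ∀ a → ¬ InULF a (𝓛 a)
𝓛∉ULF a (_ , ℓ , _ , unique) = <⇒≢ (n<1+n c) (trans (unique c shorter) (sym (unique (suc c) longer)))
  where
  c : ℕ
  c = ⌈ a /2⌉
  shorter : InL a (𝓛 a) c
  shorter = subst (λ r → InL a r c) (sym (trans (𝓛≡[1+⌈a/2⌉]*a a) (+-comm a (c * a))))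
    (t≤ℓ+ℓ⇒InL[ℓ*a+t]ℓ a c a (n≤⌈n/2⌉+⌈n/2⌉ a))
  longer : InL a (𝓛 a) (suc c)
  longer = subst (λ r → InL a r (suc c)) (sym (trans (𝓛≡[1+⌈a/2⌉]*a a) (sym (+-identityʳ (suc c * a)))))
    (t≤ℓ+ℓ⇒InL[ℓ*a+t]ℓ a (suc c) 0 z≤n)

theorem2p2 : (a : ℕ) → .⦃ _ : NonZero a ⦄ → 3 ≤ a →
    ((r : ℕ) → InS a r → r < 𝓛 a → InULF a r)
    × ¬ InULF a (𝓛 a)
    × ((r : ℕ) → InS a r → r < 𝓛 a →
        (k : ℕ) → (InL a r k → k ≡ r / a) × (k ≡ r / a → InL a r k))
theorem2p2 a _ =
    (λ r r∈S r<𝓛 → r∈S , r / a , InS⇒InL[r/a] a r∈S r<𝓛 , λ k k∈L → InL⇒ℓ≡r/a a k∈L r<𝓛)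
  , 𝓛∉ULF a
  , λ r r∈S r<𝓛 k → (λ k∈L → InL⇒ℓ≡r/a a k∈L r<𝓛) , λ { refl → InS⇒InL[r/a] a r∈S r<𝓛 }
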